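{- Let $b$ and $m$ be positive integers. If $m$ divides $b+1$ and $\operatorname{cosocle}(m)>\operatorname{rad}(b)$, then $(1,b^{k},b^{k}+1)$ is an $abc$ triple for each positive odd integer $k$.
   Context: For a positive integer $n$, $\operatorname{rad}(n)$ denotes the product of the distinct prime factors of $n$ (with $\operatorname{rad}(1)=1$), and $\operatorname{cosocle}(n)=\frac{n}{\operatorname{rad}(n)}$. An $abc$ triple is a triple $(a,b,c)$ of relatively prime positive integers with $a+b=c$ and $\operatorname{rad}(abc)<c$. -}

module Defs where

open import Data.Nat using (ℕ; zero; suc; _+_; _*_; _<_; _/_; NonZero)
open import Data.Nat.Properties using (m*n≢0)
open import Data.Nat.Divisibility using (_∣_; _∣?_)
open import Data.Nat.Primality using (Prime; prime?; prime⇒nonZero)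
open import Data.Nat.Coprimality using (Coprime)
open import Data.Nat.ListAction using (product)
open import Data.List using (List; []; _∷_; filter; upTo)
open import Data.List.Relation.Unary.All using (All; []; _∷_)
open import Data.List.Relation.Unary.All.Properties using (all-filter)
open import Data.Product using (_×_; proj₁)
open import Relation.Binary.PropositionalEquality using (_≡_)
open import Relation.Nullary.Decidable using (_×-dec_)

-- The distinct primes dividing n: every prime divisor of a positive n lies in
-- [0, n], so we filter the list 0,1,…,n.
primeDivisors : ℕ → List ℕ
primeDivisors n = filter (λ p → prime? p ×-dec (p ∣? n)) (upTo (suc n))

rad : ℕ → ℕ
rad n = product (primeDivisors n)

private
  prod-nonZero : ∀ {n xs} → All (λ p → Prime p × (p ∣ n)) xs → NonZero (product xs)
  prod-nonZero [] = _
  prod-nonZero {xs = x ∷ xs} (px ∷ pxs) =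
    m*n≢0 x (product xs) {{prime⇒nonZero (proj₁ px)}} {{prod-nonZero pxs}}

rad-nonZero : ∀ n → NonZero (rad n)
rad-nonZero n = prod-nonZero (all-filter (λ p → prime? p ×-dec (p ∣? n)) (upTo (suc n)))

cosocle : ℕ → ℕ
cosocle n = _/_ n (rad n) {{rad-nonZero n}}

-- We record coprimality of a and b, which with a + b = c is equivalent to
-- all three being relatively prime.
record IsAbcTriple (a b c : ℕ) : Set where
  field
    a-pos : 0 < a
    b-pos : 0 < b
    c-pos : 0 < c
    coprime : Coprime a b
    sum : a + b ≡ c
    rad-lt : rad (a * b * c) < c

-- Write k = 2j + 1 and N = b^k. Since k is odd, b + 1 divides N + 1, hence so does m; write
-- N + 1 = q m with m = cosocle(m) rad(m). Every prime factor of N divides b, so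
-- rad(N (N + 1)) ≤ rad(b) · q · rad(m) < cosocle(m) · q · rad(m) = N + 1.
module Submission where

open import Defs
open import Data.Nat using (ℕ; zero; suc; _+_; _*_; _^_; _<_; _>_; NonZero; >-nonZero; s≤s; z≤n)
open import Data.Nat.Properties
open import Data.Nat.Divisibility
open import Data.Nat.DivMod using (m/n*n≡m)
open import Data.Nat.Primality using (Prime; prime?; euclidsLemma; prime⇒irreducible; ¬prime[1])
open import Data.Nat.Primality.Factorisation using (factorisationHasAllPrimeFactors)
open import Data.Nat.Coprimality using (Coprime; coprime-divisor; 1-coprimeTo)
open import Data.Nat.ListAction using (product)
open import Data.Nat.ListAction.Properties using (∈⇒∣product)
open import Data.Nat.Solver using (module +-*-Solver)
open import Data.List using ([]; _∷_; upTo)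
open import Data.List.Membership.Propositional using (_∈_)
open import Data.List.Membership.Propositional.Properties using (∈-filter⁺; ∈-upTo⁺)
open import Data.List.Relation.Unary.All as All using (All; []; _∷_)
open import Data.List.Relation.Unary.All.Properties using (all-filter)
open import Data.List.Relation.Unary.AllPairs using (_∷_)
open import Data.List.Relation.Unary.Unique.Propositional using (Unique)
open import Data.List.Relation.Unary.Unique.Propositional.Properties using (upTo⁺; filter⁺)
open import Data.Product using (_,_; proj₁)
open import Data.Sum using (inj₁; inj₂)
open import Data.Empty using (⊥-elim)
open import Relation.Nullary.Decidable using (_×-dec_)
open import Relation.Binary.PropositionalEquality

distinctPrimes⇒product∣ : ∀ {n} ps → Unique ps → All Prime ps → All (_∣ n) ps → product ps ∣ n
distinctPrimes⇒product∣ [] _ _ _ = 1∣ _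
distinctPrimes⇒product∣ (p ∷ ps) (p∉ps ∷ uniq) (p-prime ∷ ps-prime) (divides t n≡t*p ∷ ps∣n) =
  subst (p * product ps ∣_) (trans (*-comm p t) (sym n≡t*p)) (*-monoʳ-∣ p ps∣t)
  where
  ps⊥p : Coprime (product ps) p
  ps⊥p {d} (d∣ps , d∣p) with prime⇒irreducible p-prime d∣p
  ... | inj₁ d≡1 = d≡1
  ... | inj₂ refl =
    ⊥-elim (All.lookup p∉ps (factorisationHasAllPrimeFactors p-prime d∣ps ps-prime) refl)
  ps∣t : product ps ∣ t
  ps∣t = coprime-divisor ps⊥p
    (subst (product ps ∣_) (trans n≡t*p (*-comm t p))
      (distinctPrimes⇒product∣ ps uniq ps-prime ps∣n))

primeDivisors-∈ : ∀ {n p} → .{{NonZero n}} → Prime p → p ∣ n → p ∈ primeDivisors n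
primeDivisors-∈ {n} p-prime p∣n =
  ∈-filter⁺ (λ p → prime? p ×-dec (p ∣? n)) (∈-upTo⁺ (s≤s (∣⇒≤ p∣n))) (p-prime , p∣n)

prime∣⇒∣rad : ∀ {n p} → .{{NonZero n}} → Prime p → p ∣ n → p ∣ rad n
prime∣⇒∣rad p-prime p∣n = ∈⇒∣product (primeDivisors-∈ p-prime p∣n)

primes∣⇒rad∣ : ∀ n {m} → (∀ {p} → Prime p → p ∣ n → p ∣ m) → rad n ∣ m
primes∣⇒rad∣ n primes∣m =
  distinctPrimes⇒product∣ (primeDivisors n) (filter⁺ P? (upTo⁺ (suc n)))
    (All.map proj₁ divisors) (All.map (λ (p-prime , p∣n) → primes∣m p-prime p∣n) divisors)
  where
  P? = λ p → prime? p ×-dec (p ∣? n)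
  divisors = all-filter P? (upTo (suc n))

rad∣n : ∀ n → rad n ∣ n
rad∣n n = primes∣⇒rad∣ n (λ _ p∣n → p∣n)

cosocle*rad≡n : ∀ n → cosocle n * rad n ≡ n
cosocle*rad≡n n = m/n*n≡m {{rad-nonZero n}} (rad∣n n)

rad[m*n]∣rad[m]*rad[n] : ∀ m n → .{{NonZero m}} → .{{NonZero n}} → rad (m * n) ∣ rad m * rad n
rad[m*n]∣rad[m]*rad[n] m n = primes∣⇒rad∣ (m * n) split
  where
  split : ∀ {p} → Prime p → p ∣ m * n → p ∣ rad m * rad n
  split p-prime p∣mn with euclidsLemma m n p-prime p∣mn
  ... | inj₁ p∣m = ∣m⇒∣m*n (rad n) (prime∣⇒∣rad p-prime p∣m)
  ... | inj₂ p∣n = ∣n⇒∣m*n (rad m) (prime∣⇒∣rad p-prime p∣n)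

prime∣m^n⇒prime∣m : ∀ {p m} n → Prime p → p ∣ m ^ n → p ∣ m
prime∣m^n⇒prime∣m zero p-prime p∣1 = ⊥-elim (¬prime[1] (subst Prime (∣1⇒≡1 p∣1) p-prime))
prime∣m^n⇒prime∣m {m = m} (suc n) p-prime p∣m^[1+n] with euclidsLemma m (m ^ n) p-prime p∣m^[1+n]
... | inj₁ p∣m = p∣m
... | inj₂ p∣m^n = prime∣m^n⇒prime∣m n p-prime p∣m^n

rad[m^n]∣rad[m] : ∀ m n → .{{NonZero m}} → rad (m ^ n) ∣ rad m
rad[m^n]∣rad[m] m n =
  primes∣⇒rad∣ (m ^ n) (λ p-prime p∣m^n → prime∣⇒∣rad p-prime (prime∣m^n⇒prime∣m n p-prime p∣m^n))

-- If m ∣ c then rad c ≤ (c / m) rad m, so c beats rad (a c) once cosocle m beats rad a.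
rad[a*c]<c : ∀ {a c m} → .{{NonZero a}} → .{{NonZero c}} →
  rad a < cosocle m → m ∣ c → rad (a * c) < c
rad[a*c]<c {a} {m = m} rad[a]<cosocle[m] (divides q refl) = begin-strict
  rad (a * (q * m))            ≤⟨ ∣⇒≤ {{m*n≢0 _ _ {{rad-nonZero a}}}} rad[a*qm]∣rad[a]*q*rad[m] ⟩
  rad a * (q * rad m)          <⟨ *-monoˡ-< (q * rad m) rad[a]<cosocle[m] ⟩
  cosocle m * (q * rad m)      ≡⟨ x*[y*z]≡y*[x*z] (cosocle m) q (rad m) ⟩
  q * (cosocle m * rad m)      ≡⟨ cong (q *_) (cosocle*rad≡n m) ⟩
  q * m                        ∎
  where
  open ≤-Reasoning
  open +-*-Solver
  instance
    q≢0 : NonZero q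
    q≢0 = m*n≢0⇒m≢0 q
    m≢0 : NonZero m
    m≢0 = m*n≢0⇒n≢0 q
    rad[m]≢0 : NonZero (rad m)
    rad[m]≢0 = rad-nonZero m
    q*rad[m]≢0 : NonZero (q * rad m)
    q*rad[m]≢0 = m*n≢0 q (rad m)
  x*[y*z]≡y*[x*z] : ∀ x y z → x * (y * z) ≡ y * (x * z)
  x*[y*z]≡y*[x*z] = solve 3 (λ x y z → x :* (y :* z) := y :* (x :* z)) refl
  rad[qm]∣q*rad[m] : rad (q * m) ∣ q * rad m
  rad[qm]∣q*rad[m] = ∣-trans (rad[m*n]∣rad[m]*rad[n] q m) (*-monoˡ-∣ (rad m) (rad∣n q))
  rad[a*qm]∣rad[a]*q*rad[m] : rad (a * (q * m)) ∣ rad a * (q * rad m)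
  rad[a*qm]∣rad[a]*q*rad[m] =
    ∣-trans (rad[m*n]∣rad[m]*rad[n] a (q * m)) (*-monoʳ-∣ (rad a) rad[qm]∣q*rad[m])

m+1∣m^odd+1 : ∀ m j → m + 1 ∣ m ^ (2 * j + 1) + 1
m+1∣m^odd+1 m zero = subst (λ x → m + 1 ∣ x + 1) (sym (*-identityʳ m)) ∣-refl
m+1∣m^odd+1 m (suc j) =
  subst (λ e → m + 1 ∣ m ^ e + 1) (sym (cong (_+ 1) (*-suc 2 j)))
    (∣m+n∣m⇒∣n (subst (m + 1 ∣_) (sym (regroup m N)) m+1∣m²[N+1]+[m+1]) (n∣m*n m))
  where
  open +-*-Solver
  N = m ^ (2 * j + 1)
  -- m² (N + 1) and m^(k+2) + 1 differ by m (m + 1), moved to both sides to avoid subtraction.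
  regroup : ∀ m N → m * (m + 1) + (m * (m * N) + 1) ≡ m * (m * (N + 1)) + (m + 1)
  regroup = solve 2 (λ m N → m :* (m :+ con 1) :+ (m :* (m :* N) :+ con 1)
                          := m :* (m :* (N :+ con 1)) :+ (m :+ con 1)) refl
  m+1∣m²[N+1]+[m+1] : m + 1 ∣ m * (m * (N + 1)) + (m + 1)
  m+1∣m²[N+1]+[m+1] = ∣m∣n⇒∣m+n (∣n⇒∣m*n m (∣n⇒∣m*n m (m+1∣m^odd+1 m j))) ∣-refl

theorem2 : (b m : ℕ) → 0 < b → 0 < m →
    m ∣ b + 1 → cosocle m > rad b →
    (j : ℕ) → IsAbcTriple 1 (b ^ (2 * j + 1)) (b ^ (2 * j + 1) + 1)
theorem2 b@(suc _) m _ _ m∣b+1 rad[b]<cosocle[m] j = record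
  { a-pos = s≤s z≤n
  ; b-pos = m^n>0 b k
  ; c-pos = N+1>0
  ; coprime = 1-coprimeTo N
  ; sum = +-comm 1 N
  ; rad-lt = subst (λ x → rad (x * (N + 1)) < N + 1) (sym (*-identityˡ N))
      (rad[a*c]<c {{m^n≢0 b k}} {{>-nonZero N+1>0}} rad[N]<cosocle[m]
        (∣-trans m∣b+1 (m+1∣m^odd+1 b j)))
  }
  where
  k = 2 * j + 1
  N = b ^ k
  N+1>0 : N + 1 > 0
  N+1>0 = m≤n+m 1 N
  rad[N]<cosocle[m] : rad N < cosocle m
  rad[N]<cosocle[m] = ≤-<-trans (∣⇒≤ {{rad-nonZero b}} (rad[m^n]∣rad[m] b k)) rad[b]<cosocle[m]
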